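{- In a 1-nested evolutionary network, no reticulation cycle has a hybrid node among its intermediate nodes.
   Context: An evolutionary network is a rooted directed acyclic graph whose leaves are bijectively labeled by a set of taxa. A hybrid node is a node of in-degree at least 2. A reticulation cycle for a hybrid node $h$ is a pair of distinct non-trivial directed paths with a common origin (the split node), both ending in $h$ (the end), that have no intermediate (non-endpoint) nodes in common; the intermediate nodes of the reticulation cycle are the intermediate nodes of these two paths. A network is 1-nested when every pair of reticulation cycles with different ends have disjoint sets of intermediate nodes. No restriction on node degrees is imposed. -}

module Defs where

open import Level using (Level; _⊔_) renaming (suc to lsuc)
open import Data.Nat using (ℕ)
open import Data.Fin using (Fin)
open import Data.List using (List; []; _∷_; _++_)
open import Data.List.Membership.Propositional using (_∈_)
open import Data.Product using (Σ; ∃; ∃-syntax; _×_; _,_)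
open import Data.Sum using (_⊎_)
open import Data.Empty using (⊥)
open import Relation.Nullary using (¬_)
open import Relation.Binary.PropositionalEquality using (_≡_; _≢_)
open import Function.Bundles using (_⤖_)

module _ {n : ℕ} (E : Fin n → Fin n → Set) where

  -- A non-trivial directed path from u to v (at least one arc), indexed by
  -- the list of its intermediate (non-endpoint) nodes, in order.
  data Path : Fin n → Fin n → List (Fin n) → Set where
    edge : ∀ {u v} → E u v → Path u v []
    cons : ∀ {u w v is} → E u w → Path w v is → Path u v (w ∷ is)

  Reach : Fin n → Fin n → Set
  Reach u v = u ≡ v ⊎ ∃[ is ] Path u v is

  Acyclic : Set
  Acyclic = ∀ v is → ¬ Path v v is

  IsRoot : Fin n → Set
  IsRoot r = (∀ u → ¬ E u r) × (∀ v → Reach r v)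

  IsLeaf : Fin n → Set
  IsLeaf u = ∀ v → ¬ E u v

  Hybrid : Fin n → Set
  Hybrid h = ∃[ u ] ∃[ v ] (u ≢ v × E u h × E v h)

  Disjoint : List (Fin n) → List (Fin n) → Set
  Disjoint xs ys = ∀ x → x ∈ xs → x ∈ ys → ⊥

  record RetCycle : Set where
    field
      split  : Fin n
      end    : Fin n
      int₁   : List (Fin n)
      int₂   : List (Fin n)
      path₁  : Path split end int₁
      path₂  : Path split end int₂
      distinct : int₁ ≢ int₂
      disjoint : Disjoint int₁ int₂

    intermediates : List (Fin n)
    intermediates = int₁ ++ int₂

  open RetCycle public

  OneNested : Set
  OneNested = ∀ (C D : RetCycle) → end C ≢ end D →
              Disjoint (intermediates C) (intermediates D)

record Network (X : Set) : Set₁ where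
  field
    n       : ℕ
    E       : Fin n → Fin n → Set
    acyclic : Acyclic E
    root    : Fin n
    isRoot  : IsRoot E root
    label   : X ⤖ Σ (Fin n) (IsLeaf E)

module Submission where

-- By symmetry let x be a hybrid node on the first side of C, which thus
-- splits as  s ⇝A x ⇝B e  with x ≠ e.  Let p be the node preceding x on A
-- and q ≠ p another in-neighbour of x.  Take a root path R through s and A
-- (so it enters x from p) and a root path T entering x from q.  Let w be
-- the last node of T lying on R or on the second side of C, and β the part
-- of T after w; β avoids R and the second side.  Then a reticulation cycle
-- ending in x (so it must avoid C's intermediates, as x ≠ e) is built
-- that nevertheless meets C, or meets another cycle ending in e:
--   * w on the second side: s ⇝ w ⇝β x against A meets C in w;
--   * w on R: the part γ of R after w and β form a cycle D ending in x;
--     if γ meets C we are done; if γ is empty, rerouting C through β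
--     meets D; otherwise A must be a single arc and γ passes through s,
--     and w ⇝ s ⇝ e against w ⇝β x ⇝B e meets D in s.

open import Defs
open import Data.List.Membership.Propositional using (_∈_)
open import Relation.Nullary using (¬_; yes; no)
open import Data.Nat using (ℕ)
open import Data.Fin using (Fin) renaming (_≟_ to _≟ᶠ_)
open import Data.List using (List; []; _∷_; _++_)
open import Data.List.Relation.Unary.Any using (here; there)
open import Data.List.Relation.Binary.Subset.Propositional using (_⊆_)
open import Data.List.Membership.Propositional.Properties using (∈-++⁺ˡ; ∈-++⁺ʳ; ∈-++⁻)
open import Data.Product using (∃; ∃₂; _×_; _,_; proj₂)
open import Data.Sum using (_⊎_; inj₁; inj₂)
open import Data.Empty using (⊥)
open import Relation.Binary.PropositionalEquality
import Data.List.Membership.DecPropositional as DecMembership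

-- The last element of the non-empty list a ∷ xs.  For a path from a to z
-- with intermediate nodes xs this is the node from which z is entered.
lastOf : ∀ {n} → Fin n → List (Fin n) → Fin n
lastOf a []       = a
lastOf a (y ∷ ys) = lastOf y ys

lastOf-++ : ∀ {n} (a : Fin n) xs b ys → lastOf a (xs ++ b ∷ ys) ≡ lastOf b ys
lastOf-++ a []       b ys = refl
lastOf-++ a (x ∷ xs) b ys = lastOf-++ x xs b ys

lastOf-∈ : ∀ {n} (a : Fin n) xs → lastOf a xs ∈ a ∷ xs
lastOf-∈ a []       = here refl
lastOf-∈ a (y ∷ ys) = there (lastOf-∈ y ys)

module _ {n : ℕ} (E : Fin n → Fin n → Set) where

  open DecMembership (_≟ᶠ_ {n}) using (_∈?_)

  lastArc : ∀ {a z is} → Path E a z is → E (lastOf a is) z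
  lastArc (edge e)   = e
  lastArc (cons e p) = lastArc p

  _++ₚ_ : ∀ {a b c is js} → Path E a b is → Path E b c js → Path E a c (is ++ b ∷ js)
  edge e   ++ₚ q = cons e q
  cons e p ++ₚ q = cons e (p ++ₚ q)

  -- Replace the final arc of a path by a path leaving the same node.
  graft : ∀ {a z is β} → Path E a z is → Path E (lastOf a is) z β → Path E a z (is ++ β)
  graft (edge e)   q = q
  graft (cons e p) q = cons e (graft p q)

  splitAt : ∀ {a z is y} → Path E a z is → y ∈ is →
            ∃₂ λ δ γ → Path E a y δ × Path E y z γ × is ≡ δ ++ y ∷ γ
  splitAt (edge e) ()
  splitAt (cons e p) (here refl) = [] , _ , edge e , p , refl
  splitAt (cons {w = w} e p) (there m) with splitAt p m
  ... | δ , γ , p₁ , p₂ , refl = w ∷ δ , γ , cons e p₁ , p₂ , refl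

  suffixFrom : ∀ {a z is y} → Path E a z is → y ∈ a ∷ is →
               ∃ λ γ → Path E y z γ × γ ⊆ is × lastOf a is ≡ lastOf y γ
  suffixFrom p (here refl) = _ , p , (λ m → m) , refl
  suffixFrom {a} p (there m) with splitAt p m
  ... | δ , γ , _ , p₂ , refl = γ , p₂ , (λ t∈ → ∈-++⁺ʳ δ (there t∈)) , lastOf-++ a δ _ γ

  fromNode : ∀ {r a z is} → Reach E r a → Path E a z is →
             ∃ λ js → Path E r z js × is ⊆ js × lastOf r js ≡ lastOf a is
  fromNode (inj₁ refl) p = _ , p , (λ m → m) , refl
  fromNode {r} {a} {is = is} (inj₂ (ks , q)) p =
    _ , q ++ₚ p , (λ m → ∈-++⁺ʳ ks (there m)) , lastOf-++ r ks a is

  ends-distinct : Acyclic E → ∀ {a b is} → Path E a b is → a ≢ b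
  ends-distinct acyc p refl = acyc _ _ p

  disjoint-sym : ∀ {xs ys} → Disjoint E xs ys → Disjoint E ys xs
  disjoint-sym d t a b = d t b a

  disjoint-⊆ʳ : ∀ {xs ys zs} → Disjoint E xs ys → zs ⊆ ys → Disjoint E xs zs
  disjoint-⊆ʳ d zs⊆ys t a b = d t a (zs⊆ys b)

  disjoint-distinct : ∀ {xs ys y} → Disjoint E xs ys → y ∈ xs → xs ≢ ys
  disjoint-distinct d y∈ refl = d _ y∈ y∈

  distinct-by-last : ∀ w {γ β} → Disjoint E γ β → lastOf w γ ≢ lastOf w β → γ ≢ β
  distinct-by-last w {[]}    d ne refl = ne refl
  distinct-by-last w {g ∷ γ} d ne refl = d g (here refl) (here refl)

  meet? : (xs ys : List (Fin n)) → (∃ λ t → t ∈ xs × t ∈ ys) ⊎ Disjoint E xs ys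
  meet? []       ys = inj₂ (λ t ())
  meet? (x ∷ xs) ys with x ∈? ys | meet? xs ys
  ... | yes x∈ | _                   = inj₁ (x , here refl , x∈)
  ... | no _   | inj₁ (t , t∈ , t∈′) = inj₁ (t , there t∈ , t∈′)
  ... | no x∉  | inj₂ d              = inj₂ λ { t (here refl) t∈ → x∉ t∈
                                                 ; t (there m) t∈ → d t m t∈ }

  LastVisit : List (Fin n) → Fin n → Fin n → List (Fin n) → Set
  LastVisit L a z is =
    ∃₂ λ w γ → w ∈ L × Path E w z γ × Disjoint E γ L × lastOf a is ≡ lastOf w γ

  visitsOrAvoids : ∀ (L : List (Fin n)) {a z is} → Path E a z is →
                   Disjoint E is L ⊎ LastVisit L a z is
  visitsOrAvoids L (edge e) = inj₁ (λ t ())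
  visitsOrAvoids L (cons {w = b} e p) with visitsOrAvoids L p | b ∈? L
  ... | inj₂ visit | _      = inj₂ visit
  ... | inj₁ avoid | yes b∈ = inj₂ (b , _ , b∈ , p , avoid , refl)
  ... | inj₁ avoid | no b∉  = inj₁ λ { t (here refl) t∈ → b∉ t∈
                                      ; t (there m) t∈ → avoid t m t∈ }

  lastVisit : ∀ (L : List (Fin n)) {a z is} → Path E a z is → a ∈ L → LastVisit L a z is
  lastVisit L p a∈ with visitsOrAvoids L p
  ... | inj₁ avoid = _ , _ , a∈ , p , avoid , refl
  ... | inj₂ visit = visit

  mkCycle : ∀ {s e is js} → Path E s e is → Path E s e js → is ≢ js → Disjoint E is js → RetCycle E
  mkCycle p₁ p₂ dis dj = record { path₁ = p₁ ; path₂ = p₂ ; distinct = dis ; disjoint = dj }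

  swap : RetCycle E → RetCycle E
  swap C = mkCycle (path₂ C) (path₁ C) (λ eq → distinct C (sym eq)) (disjoint-sym (disjoint C))

  otherParent : ∀ {x} → Hybrid E x → ∀ p → ∃ λ q → E q x × q ≢ p
  otherParent (u , v , u≢v , u→x , v→x) p with u ≟ᶠ p
  ... | yes refl = v , v→x , λ v≡u → u≢v (sym v≡u)
  ... | no u≢p   = u , u→x , u≢p

  module HybridOnCycle (ON : OneNested E) (C : RetCycle E) {x : Fin n} {pre post : List (Fin n)}
                       (A : Path E (split C) x pre) (B : Path E x (end C) post)
                       (int₁≡ : int₁ C ≡ pre ++ x ∷ post) (x≢e : x ≢ end C) where

    open RetCycle C using () renaming (split to s; end to e; path₂ to P₂; disjoint to C-disjoint)

    p : Fin n
    p = lastOf s pre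

    pre⊆int₁ : pre ⊆ int₁ C
    pre⊆int₁ m = subst (_ ∈_) (sym int₁≡) (∈-++⁺ˡ m)

    rest⊆int₁ : x ∷ post ⊆ int₁ C
    rest⊆int₁ m = subst (_ ∈_) (sym int₁≡) (∈-++⁺ʳ pre m)

    atX : (D : RetCycle E) → end D ≡ x → Disjoint E (intermediates D) (intermediates C)
    atX D eq = ON D C λ eq′ → x≢e (trans (sym eq) eq′)

    -- w on the second side: s ⇝ w ⇝β x against A ends in x and meets C in w.
    viaSecondSide : ∀ {w β} → w ∈ int₂ C → Path E w x β → Disjoint E β pre → ⊥
    viaSecondSide {w} {β} w∈ βp β#pre with splitAt P₂ w∈
    ... | δ , _ , δp , _ , int₂≡ =
      atX D refl w (∈-++⁺ˡ (∈-++⁺ʳ δ (here refl))) (∈-++⁺ʳ (int₁ C) w∈)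
      where
      δ⊆int₂ : δ ⊆ int₂ C
      δ⊆int₂ m = subst (_ ∈_) (sym int₂≡) (∈-++⁺ˡ m)
      detour#pre : Disjoint E (δ ++ w ∷ β) pre
      detour#pre t t∈ t∈pre with ∈-++⁻ δ t∈
      ... | inj₁ t∈δ         = C-disjoint t (pre⊆int₁ t∈pre) (δ⊆int₂ t∈δ)
      ... | inj₂ (here refl) = C-disjoint t (pre⊆int₁ t∈pre) w∈
      ... | inj₂ (there t∈β) = β#pre t t∈β t∈pre
      D : RetCycle E
      D = mkCycle (δp ++ₚ βp) A (disjoint-distinct detour#pre (∈-++⁺ʳ δ (here refl))) detour#pre

    -- w = p and β non-empty: rerouting C through β gives a cycle ending in
    -- e that meets the cycle (p → x, β) ending in x.
    viaLastArc : ∀ {b β} → Path E p x (b ∷ β) → Disjoint E (b ∷ β) (int₂ C) → ⊥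
    viaLastArc {b} {β} βp β#₂ =
      ON D C′ x≢e b (here refl) (∈-++⁺ˡ (∈-++⁺ˡ (∈-++⁺ʳ pre (here refl))))
      where
      D : RetCycle E
      D = mkCycle (edge (lastArc A)) βp (λ ()) (λ t ())
      rerouted#₂ : Disjoint E ((pre ++ b ∷ β) ++ x ∷ post) (int₂ C)
      rerouted#₂ t t∈ t∈₂ with ∈-++⁻ (pre ++ b ∷ β) t∈
      ... | inj₂ t∈rest = C-disjoint t (rest⊆int₁ t∈rest) t∈₂
      ... | inj₁ t∈′ with ∈-++⁻ pre t∈′
      ...   | inj₁ t∈pre = C-disjoint t (pre⊆int₁ t∈pre) t∈₂
      ...   | inj₂ t∈β   = β#₂ t t∈β t∈₂
      C′ : RetCycle E
      C′ = mkCycle (graft A βp ++ₚ B) P₂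
             (disjoint-distinct rerouted#₂ (∈-++⁺ʳ (pre ++ b ∷ β) (here refl))) rerouted#₂

    -- γ avoids C but passes through s: then w ⇝ s ⇝ e against w ⇝β x ⇝B e
    -- ends in e and meets the cycle (γ, β), which ends in x, in s.
    viaSplitNode : ∀ {w γ β} → Path E w x γ → Path E w x β → s ∈ γ →
                   Disjoint E γ (int₁ C) → Disjoint E γ β → Disjoint E β (int₂ C) → ⊥
    viaSplitNode {γ = γ} {β} γp βp s∈γ γ#₁ γ#β β#₂ with splitAt γp s∈γ
    ... | γ₁ , _ , γ₁p , _ , refl =
      ON D C″ x≢e s (∈-++⁺ˡ s∈γ) (∈-++⁺ˡ (∈-++⁺ʳ γ₁ (here refl)))
      where
      D : RetCycle E
      D = mkCycle γp βp (disjoint-distinct γ#β s∈γ) γ#β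
      left : ∀ {t} → t ∈ γ₁ ++ s ∷ int₂ C → t ∈ γ ⊎ t ∈ int₂ C
      left m with ∈-++⁻ γ₁ m
      ... | inj₁ t∈γ₁       = inj₁ (∈-++⁺ˡ t∈γ₁)
      ... | inj₂ (here refl) = inj₁ s∈γ
      ... | inj₂ (there t∈₂) = inj₂ t∈₂
      right : ∀ {t} → t ∈ β ++ x ∷ post → t ∈ β ⊎ t ∈ int₁ C
      right m with ∈-++⁻ β m
      ... | inj₁ t∈β    = inj₁ t∈β
      ... | inj₂ t∈rest = inj₂ (rest⊆int₁ t∈rest)
      sides# : Disjoint E (γ₁ ++ s ∷ int₂ C) (β ++ x ∷ post)
      sides# t l r with left l | right r
      ... | inj₁ t∈γ | inj₁ t∈β = γ#β t t∈γ t∈β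
      ... | inj₁ t∈γ | inj₂ t∈₁ = γ#₁ t t∈γ t∈₁
      ... | inj₂ t∈₂ | inj₁ t∈β = β#₂ t t∈β t∈₂
      ... | inj₂ t∈₂ | inj₂ t∈₁ = C-disjoint t t∈₁ t∈₂
      C″ : RetCycle E
      C″ = mkCycle (γ₁p ++ₚ P₂) (βp ++ₚ B)
             (disjoint-distinct sides# (∈-++⁺ʳ γ₁ (here refl))) sides#

    viaTwoParents : ∀ {w γ β} → Path E w x γ → Path E w x β →
                    lastOf w γ ≡ p → lastOf w β ≢ p → Disjoint E γ β → Disjoint E β (int₂ C) → ⊥
    viaTwoParents {w} {γ} γp βp γ↦p β↛p γ#β β#₂ with meet? γ (int₁ C)
    ... | inj₁ (t , t∈γ , t∈₁) = atX D refl t (∈-++⁺ˡ t∈γ) (∈-++⁺ˡ t∈₁)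
      where
      D : RetCycle E
      D = mkCycle γp βp (distinct-by-last w γ#β (λ eq → β↛p (trans (sym eq) γ↦p))) γ#β
    viaTwoParents {γ = []} {[]}    _ _  refl β↛p _ _ | inj₂ _ = β↛p refl
    viaTwoParents {γ = []} {_ ∷ _} _ βp refl _   _ β#₂ | inj₂ _ = viaLastArc βp β#₂
    viaTwoParents {γ = g ∷ γ′} γp βp γ↦p _ γ#β β#₂ | inj₂ γ#₁
      with lastOf-∈ s pre | subst (_∈ g ∷ γ′) γ↦p (lastOf-∈ g γ′)
    ... | here p≡s    | p∈γ = viaSplitNode γp βp (subst (_∈ g ∷ γ′) p≡s p∈γ) γ#₁ γ#β β#₂
    ... | there p∈pre | p∈γ = γ#₁ p p∈γ (pre⊆int₁ p∈pre)

    notHybrid : ∀ {r} → (∀ v → Reach E r v) → ¬ Hybrid E x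
    -- T: root path entering x from q;  R: root path through A;
    -- w: last node of T on R or on the second side of C.
    notHybrid {r} reach hyb with otherParent hyb p
    ... | q , q→x , q≢p with fromNode (reach q) (edge q→x) | fromNode (reach s) A
    ... | τ , T , _ , τ↦q | ρ , R , pre⊆ρ , ρ↦p with lastVisit ((r ∷ ρ) ++ int₂ C) T (here refl)
    ... | w , β , w∈ , βp , β#L , τ≡β with ∈-++⁻ (r ∷ ρ) w∈
    ... | inj₂ w∈₂ = viaSecondSide w∈₂ βp (disjoint-⊆ʳ β#L (λ m → ∈-++⁺ˡ (there (pre⊆ρ m))))
    ... | inj₁ w∈R with suffixFrom R w∈R
    ...   | γ , γp , γ⊆ρ , ρ≡γ =
      viaTwoParents γp βp (trans (sym ρ≡γ) ρ↦p) (λ eq → q≢p (trans (trans (sym τ↦q) τ≡β) eq))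
        (disjoint-sym (disjoint-⊆ʳ β#L (λ m → ∈-++⁺ˡ (there (γ⊆ρ m)))))
        (disjoint-⊆ʳ β#L (∈-++⁺ʳ (r ∷ ρ)))

  noHybridOnFirstSide : Acyclic E → OneNested E → ∀ {r} → (∀ v → Reach E r v) →
                        (C : RetCycle E) → ∀ {x} → x ∈ int₁ C → ¬ Hybrid E x
  noHybridOnFirstSide acyc ON reach C x∈₁ with splitAt (path₁ C) x∈₁
  ... | pre , post , A , B , int₁≡ =
    HybridOnCycle.notHybrid ON C A B int₁≡ (ends-distinct acyc B) reach

  noHybridOnCycle : Acyclic E → OneNested E → ∀ {r} → (∀ v → Reach E r v) →
                    (C : RetCycle E) → ∀ {x} → x ∈ intermediates C → ¬ Hybrid E x
  noHybridOnCycle acyc ON reach C x∈ with ∈-++⁻ (int₁ C) x∈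
  ... | inj₁ x∈₁ = noHybridOnFirstSide acyc ON reach C x∈₁
  ... | inj₂ x∈₂ = noHybridOnFirstSide acyc ON reach (swap C) x∈₂

lemma3 : {X : Set} (N : Network X) → OneNested (Network.E N) →
         (C : RetCycle (Network.E N)) → ∀ x →
         x ∈ intermediates C → ¬ Hybrid (Network.E N) x
lemma3 N ON C x x∈ =
  noHybridOnCycle (Network.E N) (Network.acyclic N) ON (proj₂ (Network.isRoot N)) C x∈
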